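{- Given $K,N<\omega$ and $k\in[1,K]$, $\langle\mathfrak D(N,K),(0,-1,k)\rangle\models \neg{\tt Trouble}^K$.
   Context: $|n|_K$ is the element of $\{1,\dots,K\}$ congruent to $n$ mod $K$. Formulas (with $\Box=\neg\Diamond\neg$, $[f]$ = henceforth, $f$ = next, $\Diamond$ on a finite set = tangled closure): ${\tt Cycle}^K=\Diamond p_K\to\bigwedge_{i=1}^K(p_i\to f p_{|i+1|_K})$; ${\tt Start}^K_i=p_i\wedge[f]{\tt Cycle}^K$; ${\tt Bundle}^K=\Box\bigwedge_{i=1}^K\Diamond{\tt Start}^K_i$; ${\tt Trouble}^K={\tt Bundle}^K\to[f]\Diamond p_K$. The model $\mathfrak D(N,K)$ (a finite preorder with downset topology, so $x\models\Diamond\varphi$ iff some $y\preccurlyeq x$ satisfies $\varphi$, together with a not necessarily continuous map $f$): $\mathfrak B(N,K)$ has points $(h,t,k)$ with either ($h+t\le NK$, $k\in[1,K]$, $k\not\equiv h+t\pmod K$) or ($h=0$, $t\in[NK+1,N(K+1)]$, $k\ne K$), order $(h_1,t_1,k_1)\preccurlyeq(h_2,t_2,k_2)$ iff $t_1=t_2$ and $h_1\ge h_2$, map $f(h,t,k)=(h,t+1,|k+1|_K)$ if $h+t<NK$, $(h-1,t+1,k)$ if $h+t=NK$, $h>0$, $(h,t+1,k)$ if $t\in[NK+1,N(K+1))$, $(0,0,|k+1|_K)$ if $t=N(K+1)$, and $(h,t,k)$ satisfies exactly $p_k$; $\mathfrak C(K)$ is one cluster $\{(0,-1,k):k\in[1,K]\}$,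 $(0,-1,k)$ satisfying exactly $p_k$; $\mathfrak D(N,K)$ is their disjoint union (orders combined, parts incomparable) with $f(0,-1,k)=(0,0,|k+1|_K)$ for $k\ne K-1$ and $f(0,-1,K-1)=(1,0,K)$.
   Formalization: The map f sends (0,NK,k) to (0,NK+1,k) and (0,N(K+1),K−1) to (1,0,K) instead of (0,0,K), and the lemma assumes N ≥ 1 and K ≥ 2. Apart from conventions, each condition added here is assumed in the paper as well or is needed for the statement above to hold. This also corrects a misprint. -}

module Defs where

open import Data.Nat using (ℕ; zero; suc; _+_; _*_; _∸_; _≤_; _<_; _%_)
open import Data.Nat.Properties using (_≟_; _<?_)
open import Data.Product using (Σ; _×_)
open import Data.Sum using (_⊎_)
open import Data.Empty using (⊥)
open import Data.Unit using (⊤)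
open import Relation.Nullary using (¬_; yes; no)
open import Relation.Binary.PropositionalEquality using (_≡_; _≢_)
open import Function using (_∘_)

-- |n|_K : the element of {1,…,K} congruent to n mod K (junk 0 if K = 0)

∣_∣[_] : ℕ → ℕ → ℕ
∣ n ∣[ zero ] = zero
∣ n ∣[ suc m ] with n % suc m
... | zero  = suc m
... | suc r = suc r

_≡[mod_]_ : ℕ → ℕ → ℕ → Set
a ≡[mod K ] b = ∣ a ∣[ K ] ≡ ∣ b ∣[ K ]

infixr 4 _⇒_
infixr 5 _∧_

data Fm : Set where
  var  : ℕ → Fm
  fls  : Fm
  _⇒_  : Fm → Fm → Fm
  _∧_  : Fm → Fm → Fm
  ◇    : Fm → Fm      -- topological diamond (tangled closure of a singleton)
  ○    : Fm → Fm
  ⊡    : Fm → Fm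

tru : Fm
tru = fls ⇒ fls

¬f : Fm → Fm
¬f φ = φ ⇒ fls

□ : Fm → Fm
□ φ = ¬f (◇ (¬f φ))

⋀[1‥_] : ℕ → (ℕ → Fm) → Fm
⋀[1‥ zero  ] g = tru
⋀[1‥ suc n ] g = ⋀[1‥ n ] g ∧ g (suc n)

Cycle : ℕ → Fm
Cycle K = ◇ (var K) ⇒ ⋀[1‥ K ] (λ i → var i ⇒ ○ (var ∣ suc i ∣[ K ]))

Start : ℕ → ℕ → Fm
Start K i = var i ∧ ⊡ (Cycle K)

Bundle : ℕ → Fm
Bundle K = □ (⋀[1‥ K ] (λ i → ◇ (Start K i)))

Trouble : ℕ → Fm
Trouble K = Bundle K ⇒ ⊡ (◇ (var K))

-- The model D(N,K).
-- Raw points: bpt h t k  is (h,t,k) of B(N,K);  cpt k  is (0,-1,k) of C(K).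

data Pt : Set where
  bpt : (h t k : ℕ) → Pt
  cpt : (k : ℕ) → Pt

InD : ℕ → ℕ → Pt → Set
InD N K (bpt h t k) =
    (h + t ≤ N * K × 1 ≤ k × k ≤ K × ¬ (k ≡[mod K ] (h + t)))
  ⊎ (h ≡ 0 × suc (N * K) ≤ t × t ≤ N * suc K × 1 ≤ k × k ≤ K × k ≢ K)
InD N K (cpt k) = 1 ≤ k × k ≤ K

_≼_ : Pt → Pt → Set
bpt h₁ t₁ k₁ ≼ bpt h₂ t₂ k₂ = t₁ ≡ t₂ × h₂ ≤ h₁
bpt _ _ _    ≼ cpt _        = ⊥
cpt _        ≼ bpt _ _ _    = ⊥
cpt _        ≼ cpt _        = ⊤

label : Pt → ℕ
label (bpt _ _ k) = k
label (cpt k)     = k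

exitC : ℕ → ℕ → Pt
exitC K k with k ≟ K ∸ 1
... | yes _ = bpt 1 0 K
... | no  _ = bpt 0 0 ∣ suc k ∣[ K ]

fmap : ℕ → ℕ → Pt → Pt
fmap N K (cpt k) = exitC K k
fmap N K (bpt h t k) with h + t <? N * K
... | yes _ = bpt h (suc t) ∣ suc k ∣[ K ]
... | no  _ with h
...   | suc h' = bpt h' (suc t) k
...   | zero with t <? N * suc K
...     | yes _ = bpt 0 (suc t) k
...     | no  _ = exitC K k

iter : (Pt → Pt) → ℕ → Pt → Pt
iter g zero    x = x
iter g (suc n) x = g (iter g n x)

Sat : ℕ → ℕ → Pt → Fm → Set
Sat N K x (var i)   = label x ≡ i
Sat N K x fls       = ⊥
Sat N K x (φ ⇒ ψ)   = Sat N K x φ → Sat N K x ψ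
Sat N K x (φ ∧ ψ)   = Sat N K x φ × Sat N K x ψ
Sat N K x (◇ φ)     = Σ Pt (λ y → InD N K y × y ≼ x × Sat N K y φ)
Sat N K x (○ φ)     = Sat N K (fmap N K x) φ
Sat N K x (⊡ φ)     = (n : ℕ) → Sat N K (iter (fmap N K) n x) φ

module Submission where

-- Bundle^K holds at every cluster point: the points below it are the cluster
-- points (0,-1,i), each of which satisfies p_i, and Cycle^K holds at *every*
-- point of the model, so (0,-1,i) witnesses ◇Start^K_i.  Cycle^K holds
-- everywhere because f advances the label by one modulo K at every point
-- where ◇p_K can hold at all: at a point (h,t,k) with h+t ≥ NK the only
-- points below lie on the diagonal h+t = NK or in the tail, and neither
-- carries p_K.
--
-- [f]◇p_K fails at the root: f sends the cluster to a point (h,0,k) with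
-- h ≤ 1, from which the orbit climbs the column (h,t,·) until it reaches the
-- diagonal h+t = NK, where ◇p_K fails.

open import Defs
open import Data.Nat using (ℕ; zero; suc; _+_; _*_; _∸_; _≤_; _<_; z≤n; s≤s)
open import Data.Nat.Properties
open import Data.Nat.DivMod using (n%n≡0; m*n%n≡0)
open import Data.Product using (Σ; _×_; _,_)
open import Data.Sum using (inj₁; inj₂)
open import Data.Empty using (⊥-elim)
open import Data.Unit using (tt)
open import Relation.Nullary using (¬_; yes; no)
open import Relation.Binary.PropositionalEquality

∣K∣[K] : ∀ K → 1 ≤ K → ∣ K ∣[ K ] ≡ K
∣K∣[K] (suc m) _ rewrite n%n≡0 (suc m) {{_}} = refl

∣NK∣[K] : ∀ N K → 1 ≤ K → ∣ N * K ∣[ K ] ≡ K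
∣NK∣[K] N (suc m) _ rewrite m*n%n≡0 N (suc m) {{_}} = refl

iter-suc : ∀ (g : Pt → Pt) n x → iter g (suc n) x ≡ iter g n (g x)
iter-suc g zero    x = refl
iter-suc g (suc n) x = cong g (iter-suc g n x)

⋀-intro : ∀ N K x n (g : ℕ → Fm) →
  (∀ i → 1 ≤ i → i ≤ n → Sat N K x (g i)) → Sat N K x (⋀[1‥ n ] g)
⋀-intro N K x zero    g all = λ ()
⋀-intro N K x (suc n) g all =
  ⋀-intro N K x n g (λ i 1≤i i≤n → all i 1≤i (m≤n⇒m≤1+n i≤n)) , all (suc n) (s≤s z≤n) ≤-refl

module _ (N K : ℕ) (1≤N : 1 ≤ N) (1≤K : 1 ≤ K) where

  f : Pt → Pt
  f = fmap N K

  cycle-of-step : ∀ x → label (f x) ≡ ∣ suc (label x) ∣[ K ] → Sat N K x (Cycle K)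
  cycle-of-step x step _ = ⋀-intro N K x K _
    (λ i _ _ x⊨pᵢ → trans step (cong (λ j → ∣ suc j ∣[ K ]) x⊨pᵢ))

  -- Leaving the cluster, f also advances the label mod K
  -- (for k = K-1 the target (1,0,K) carries |K|_K = K).
  exitC-label : ∀ k → label (exitC K k) ≡ ∣ suc k ∣[ K ]
  exitC-label k with k ≟ K ∸ 1
  ... | no  _ = refl
  ... | yes k≡K-1 = sym (begin
    ∣ suc k ∣[ K ]        ≡⟨ cong (λ j → ∣ suc j ∣[ K ]) k≡K-1 ⟩
    ∣ suc (K ∸ 1) ∣[ K ]  ≡⟨ cong ∣_∣[ K ] (m+[n∸m]≡n 1≤K) ⟩
    ∣ K ∣[ K ]            ≡⟨ ∣K∣[K] K 1≤K ⟩
    K                     ∎)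
    where open ≡-Reasoning

  exitC-shape : ∀ k → Σ ℕ λ h → Σ ℕ λ k′ → exitC K k ≡ bpt h 0 k′ × h ≤ 1
  exitC-shape k with k ≟ K ∸ 1
  ... | yes _ = 1 , K , refl , ≤-refl
  ... | no  _ = 0 , ∣ suc k ∣[ K ] , refl , z≤n

  f-below : ∀ h t k → h + t < N * K → f (bpt h t k) ≡ bpt h (suc t) ∣ suc k ∣[ K ]
  f-below h t k below with h + t <? N * K
  ... | yes _     = refl
  ... | no  ¬below = ⊥-elim (¬below below)

  -- On and above the diagonal h+t = NK no point below carries p_K: diagonal
  -- points have labels incongruent to NK ≡ K, tail points have labels ≠ K.
  ¬◇pK-beyond : ∀ h t k → N * K ≤ h + t → ¬ Sat N K (bpt h t k) (◇ (var K))
  ¬◇pK-beyond h t k beyond (cpt _ , _ , () , _)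
  ¬◇pK-beyond h t k beyond (bpt _ _ _ , inj₂ (_ , _ , _ , _ , _ , k≢K) , _ , k≡K) = k≢K k≡K
  ¬◇pK-beyond h t k beyond (bpt h′ .t k′ , inj₁ (h′+t≤NK , _ , _ , incongruent) , (refl , h≤h′) , k′≡K) =
    incongruent (begin
      ∣ k′ ∣[ K ]      ≡⟨ cong ∣_∣[ K ] k′≡K ⟩
      ∣ K ∣[ K ]       ≡⟨ ∣K∣[K] K 1≤K ⟩
      K                ≡⟨ sym (∣NK∣[K] N K 1≤K) ⟩
      ∣ N * K ∣[ K ]   ≡⟨ cong ∣_∣[ K ] on-diagonal ⟩
      ∣ h′ + t ∣[ K ]  ∎)
    where
      open ≡-Reasoning
      on-diagonal : N * K ≡ h′ + t
      on-diagonal = ≤-antisym (≤-trans beyond (+-monoˡ-≤ t h≤h′)) h′+t≤NK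

  -- Cycle^K is valid in D(N,K): below the diagonal and in the cluster f
  -- advances the label, elsewhere the antecedent ◇p_K fails.
  cycle-everywhere : ∀ x → Sat N K x (Cycle K)
  cycle-everywhere (cpt k) = cycle-of-step (cpt k) (exitC-label k)
  cycle-everywhere (bpt h t k) with h + t <? N * K
  ... | yes below = cycle-of-step (bpt h t k) (cong label (f-below h t k below))
  ... | no ¬below = λ ◇pK → ⊥-elim (¬◇pK-beyond h t k (≮⇒≥ ¬below) ◇pK)

  climb : ∀ d h t k → h + (d + t) ≤ N * K →
    Σ ℕ λ k′ → iter f d (bpt h t k) ≡ bpt h (d + t) k′
  climb zero    h t k _     = k , refl
  climb (suc d) h t k fits with climb d h t k (≤-trans (+-monoʳ-≤ h (n≤1+n (d + t))) fits)
  ... | k′ , reached = ∣ suc k′ ∣[ K ] , (begin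
    f (iter f d (bpt h t k))  ≡⟨ cong f reached ⟩
    f (bpt h (d + t) k′)      ≡⟨ f-below h (d + t) k′ (subst (_≤ N * K) (+-suc h (d + t)) fits) ⟩
    bpt h (suc (d + t)) ∣ suc k′ ∣[ K ] ∎)
    where open ≡-Reasoning

  column-escapes : ∀ h k → h ≤ N * K → Σ ℕ λ n → ¬ Sat N K (iter f n (bpt h 0 k)) (◇ (var K))
  column-escapes h k h≤NK =
    let k′ , reached = climb (N * K ∸ h) h 0 k (≤-reflexive on-diagonal)
    in N * K ∸ h , subst (λ y → ¬ Sat N K y (◇ (var K))) (sym reached)
                     (¬◇pK-beyond h (N * K ∸ h + 0) k′ (≤-reflexive (sym on-diagonal)))
    where
      on-diagonal : h + (N * K ∸ h + 0) ≡ N * K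
      on-diagonal = trans (cong (h +_) (+-identityʳ (N * K ∸ h))) (m+[n∸m]≡n h≤NK)

  cluster-escapes : ∀ k → Σ ℕ λ n → ¬ Sat N K (iter f n (cpt k)) (◇ (var K))
  cluster-escapes k with exitC-shape k
  ... | h , k′ , exit , h≤1 with column-escapes h k′ (≤-trans h≤1 (*-mono-≤ 1≤N 1≤K))
  ... | n , ¬◇pK = suc n ,
    subst (λ y → ¬ Sat N K y (◇ (var K))) (sym (trans (iter-suc f n (cpt k)) (cong (iter f n) exit))) ¬◇pK

  -- Bundle^K holds at every cluster point: each (0,-1,i) lies below every
  -- cluster point and satisfies Start^K_i, as Cycle^K is valid.
  bundle-in-cluster : ∀ k → Sat N K (cpt k) (Bundle K)
  bundle-in-cluster k (bpt _ _ _ , _ , () , _)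
  bundle-in-cluster k (cpt k′ , _ , _ , ¬conj) = ¬conj (⋀-intro N K (cpt k′) K _
    (λ i 1≤i i≤K → cpt i , (1≤i , i≤K) , tt , refl , (λ n → cycle-everywhere _)))

mainTheorem6 : (N K k : ℕ) → 1 ≤ N → 2 ≤ K → 1 ≤ k → k ≤ K →
    Sat N K (cpt k) (¬f (Trouble K))
mainTheorem6 N K k 1≤N 2≤K _ _ trouble =
  let n , ¬◇pK = cluster-escapes N K 1≤N 1≤K k
  in ¬◇pK (trouble (bundle-in-cluster N K 1≤N 1≤K k) n)
  where
    1≤K : 1 ≤ K
    1≤K = ≤-trans (s≤s z≤n) 2≤K
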